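{- Let $A,B\in\mathbb{Z}$ with $A\equiv B\equiv 1\pmod 4$, and let $\mathcal{F}_{3,A,B}(x)=x^{8}+Ax^{6}+Bx^{4}+Ax^{2}+1$. Then $\mathcal{F}_{3,A,B}(x)$ is reducible over $\mathbb{Q}$ if and only if there exist $s,t\in\mathbb{Z}$ such that \[A=4t-4s^2-4s+1\quad\text{and}\quad B\in\{4t^2+4t-8s^2-8s+1,\ 4t^2+4t+8s^2+8s+5\}.\] -}

module Defs where

open import Data.Nat using (ℕ; zero; suc; _<_; _≤_)
open import Data.Integer using (ℤ; +_)
open import Data.Rational using (ℚ; 0ℚ; _+_; _*_; _/_)
open import Data.List using (List; []; _∷_)
open import Data.Product using (Σ; _×_; ∃; ∃-syntax)
open import Relation.Binary.PropositionalEquality using (_≡_; _≢_)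

-- Polynomials over ℚ as coefficient lists, lowest degree first.
Poly : Set
Poly = List ℚ

coeff : Poly → ℕ → ℚ
coeff []       _       = 0ℚ
coeff (a ∷ p)  zero    = a
coeff (a ∷ p)  (suc k) = coeff p k

-- coefficient of x^k in the product p * q :  Σ_{i+j=k} p_i q_j
-- convAux p q k = Σ_{i=0}^{k} p_i q_{k-i}, written by recursion on p
conv : Poly → Poly → ℕ → ℚ
conv []      q k       = 0ℚ
conv (a ∷ p) q zero    = a * coeff q zero
conv (a ∷ p) q (suc k) = a * coeff q (suc k) + conv p q k

HasDegree : Poly → ℕ → Set
HasDegree p d = (coeff p d ≢ 0ℚ) × (∀ k → d < k → coeff p k ≡ 0ℚ)

ReducibleQ : Poly → Set
ReducibleQ f = ∃[ g ] ∃[ h ] ∃[ d ] ∃[ e ]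
  (HasDegree g d × HasDegree h e × 1 ≤ d × 1 ≤ e
   × (∀ k → coeff f k ≡ conv g h k))

toℚ : ℤ → ℚ
toℚ z = z / 1

F3 : ℤ → ℤ → Poly
F3 A B = let a = toℚ A ; b = toℚ B ; o = toℚ (+ 1) ; z = 0ℚ in
  o ∷ z ∷ a ∷ z ∷ b ∷ z ∷ a ∷ z ∷ o ∷ []

module Submission where

-- A rational factorisation of F = x⁸ + Ax⁶ + Bx⁴ + Ax² + 1 can be scaled to an integral one and, by
-- Gauss's lemma, made primitive, keeping the degrees d + e = 8. Modulo 2, F ≡ (x⁴ + x³ + x² + x + 1)²
-- with the quartic irreducible over 𝔽₂ (checked by exhaustive evaluation), so d = e = 4 and the first
-- factor has odd coefficients. Once both factors are monic their constant terms are the same unit ε,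
-- and the coefficients of x, x⁵ and x⁷ force the second factor to be G(-x). For ε = -1 the coefficients
-- of x² and x⁶ give 4g₂ = g₃² - g₁², impossible for odd gᵢ; for ε = 1 they give g₃ = ±g₁, and writing
-- g₁ = 2s + 1, g₂ = 2t + 1 yields the two families. Conversely, for each family G(x) · G(-x) = F with
-- G = x⁴ ± g₁x³ + g₂x² + g₁x + 1.

open import Defs

open import Algebra.Bundles using (CommutativeSemiring; CommutativeRing)
open import Data.Bool.Base using (Bool; true; false; not; _∧_; _∨_; _xor_; T)
open import Data.Bool.ListAction using (and)
open import Data.Bool.Properties as Bool using (xor-∧-commutativeRing; T-∧; T-∨)
open import Data.Empty using (⊥; ⊥-elim)
open import Data.Integer.Base using (ℤ; +_; -[1+_]; _+_; _-_; _*_; -_; ∣_∣)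
import Data.Integer.Properties as ℤ
open import Data.Integer.Divisibility using (_∣_)
open import Data.Integer.DivMod using (_%_; _/_; n%d<d; a≡a%n+[a/n]*n)
import Data.Integer.Divisibility.Signed as ℤ∣
open import Data.Integer.Tactic.RingSolver using (solve-∀)
open import Data.List.Base as List using (List; []; _∷_)
open import Data.List.Relation.Unary.All using (All; []; _∷_)
open import Data.Nat.Base as ℕ using (ℕ; zero; suc; z≤n; s≤s; _≤_; _<_)
import Data.Nat.Properties as ℕ
import Data.Nat.Divisibility as ℕ∣
open import Data.Nat.ListAction using (product)
open import Data.Nat.Primality using (Prime; euclidsLemma; prime⇒nonZero)
open import Data.Nat.Primality.Factorisation using (factorise; PrimeFactorisation)
import Data.Rational as ℚ
import Data.Rational.Properties as ℚ
open import Data.Rational.Base using (ℚ; 0ℚ; 1ℚ)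
open import Data.Rational.Literals using (fromℤ)
open import Data.Rational.Solver using (module +-*-Solver)
import Data.Rational.Unnormalised as ℚᵘ
import Data.Rational.Unnormalised.Properties as ℚᵘ
open import Data.Product using (_×_; _,_; proj₁; proj₂; ∃-syntax)
open import Data.Sum using (_⊎_; inj₁; inj₂; [_,_]′)
open import Function.Base using (_∘_; case_of_)
open import Function.Bundles using (_⇔_; mk⇔; Equivalence)
open import Relation.Nullary using (¬_; yes; no)
open import Relation.Nullary.Decidable using (⌊_⌋; fromWitness)
open import Relation.Binary.Definitions using (tri<; tri≈; tri>)
open import Relation.Binary.PropositionalEquality
  using (_≡_; _≢_; refl; sym; trans; cong; cong₂; subst; _≗_; module ≡-Reasoning)

-- Convolution of coefficient sequences

module Convolution {c ℓ} (R : CommutativeSemiring c ℓ) where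

  open CommutativeSemiring R renaming (_+_ to _⊕_; _*_ to _⊗_; refl to ≈-refl; sym to ≈-sym; trans to ≈-trans)
  open import Relation.Binary.Reasoning.Setoid setoid
  open import Algebra.Properties.CommutativeSemigroup *-commutativeSemigroup using (x∙yz≈y∙xz)

  shift : (ℕ → Carrier) → ℕ → Carrier
  shift G i = G (suc i)

  infixl 7 _⊛_
  _⊛_ : (ℕ → Carrier) → (ℕ → Carrier) → ℕ → Carrier
  (G ⊛ H) zero    = G 0 ⊗ H 0
  (G ⊛ H) (suc k) = G 0 ⊗ H (suc k) ⊕ (shift G ⊛ H) k

  infix 4 _≋_
  _≋_ : (ℕ → Carrier) → (ℕ → Carrier) → Set ℓ
  G ≋ H = ∀ i → G i ≈ H i

  VanishesAbove : ℕ → (ℕ → Carrier) → Set ℓ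
  VanishesAbove d G = ∀ i → d < i → G i ≈ 0#

  ⊛-cong : ∀ {G G′ H H′} → G ≋ G′ → H ≋ H′ → G ⊛ H ≋ G′ ⊛ H′
  ⊛-cong G≋G′ H≋H′ zero    = *-cong (G≋G′ 0) (H≋H′ 0)
  ⊛-cong G≋G′ H≋H′ (suc k) = +-cong (*-cong (G≋G′ 0) (H≋H′ (suc k))) (⊛-cong (G≋G′ ∘ suc) H≋H′ k)

  ⊛-zeroˡ : ∀ {G} H → G ≋ (λ _ → 0#) → G ⊛ H ≋ (λ _ → 0#)
  ⊛-zeroˡ H G≋0 zero    = ≈-trans (*-congʳ (G≋0 0)) (zeroˡ (H 0))
  ⊛-zeroˡ H G≋0 (suc k) = begin
    _       ≈⟨ +-cong (≈-trans (*-congʳ (G≋0 0)) (zeroˡ _)) (⊛-zeroˡ H (G≋0 ∘ suc) k) ⟩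
    0# ⊕ 0# ≈⟨ +-identityˡ 0# ⟩
    0#      ∎

  ⊛-scaleˡ : ∀ a G H → (λ i → a ⊗ G i) ⊛ H ≋ (λ k → a ⊗ (G ⊛ H) k)
  ⊛-scaleˡ a G H zero    = *-assoc a (G 0) (H 0)
  ⊛-scaleˡ a G H (suc k) = begin
    a ⊗ G 0 ⊗ H (suc k) ⊕ ((λ i → a ⊗ shift G i) ⊛ H) k
      ≈⟨ +-cong (*-assoc a (G 0) (H (suc k))) (⊛-scaleˡ a (shift G) H k) ⟩
    a ⊗ (G 0 ⊗ H (suc k)) ⊕ a ⊗ (shift G ⊛ H) k
      ≈⟨ ≈-sym (distribˡ a _ _) ⟩
    a ⊗ (G 0 ⊗ H (suc k) ⊕ (shift G ⊛ H) k) ∎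

  ⊛-scaleʳ : ∀ a G H → G ⊛ (λ i → a ⊗ H i) ≋ (λ k → a ⊗ (G ⊛ H) k)
  ⊛-scaleʳ a G H zero    = x∙yz≈y∙xz (G 0) a (H 0)
  ⊛-scaleʳ a G H (suc k) = begin
    G 0 ⊗ (a ⊗ H (suc k)) ⊕ (shift G ⊛ (λ i → a ⊗ H i)) k
      ≈⟨ +-cong (x∙yz≈y∙xz (G 0) a (H (suc k))) (⊛-scaleʳ a (shift G) H k) ⟩
    a ⊗ (G 0 ⊗ H (suc k)) ⊕ a ⊗ (shift G ⊛ H) k
      ≈⟨ ≈-sym (distribˡ a _ _) ⟩
    a ⊗ (G 0 ⊗ H (suc k) ⊕ (shift G ⊛ H) k) ∎

  ⊛-vanishesAbove : ∀ d e G H → VanishesAbove d G → VanishesAbove e H → VanishesAbove (d ℕ.+ e) (G ⊛ H)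
  ⊛-vanishesAbove d       e G H G↑ H↑ zero    ()
  ⊛-vanishesAbove zero    e G H G↑ H↑ (suc k) (s≤s e<k) = begin
    G 0 ⊗ H (suc k) ⊕ (shift G ⊛ H) k
      ≈⟨ +-cong (≈-trans (*-congˡ (H↑ (suc k) (s≤s e<k))) (zeroʳ (G 0))) (⊛-zeroˡ H (λ i → G↑ (suc i) (s≤s z≤n)) k) ⟩
    0# ⊕ 0#
      ≈⟨ +-identityˡ 0# ⟩
    0# ∎
  ⊛-vanishesAbove (suc d) e G H G↑ H↑ (suc k) (s≤s d+e<k) = begin
    G 0 ⊗ H (suc k) ⊕ (shift G ⊛ H) k
      ≈⟨ +-cong (≈-trans (*-congˡ (H↑ (suc k) (s≤s (ℕ.≤-trans (ℕ.m≤n+m e (suc d)) d+e<k)))) (zeroʳ (G 0)))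
                (⊛-vanishesAbove d e (shift G) H (λ i → G↑ (suc i) ∘ s≤s) H↑ k d+e<k) ⟩
    0# ⊕ 0#
      ≈⟨ +-identityˡ 0# ⟩
    0# ∎

  ⊛-leading : ∀ d e G H → VanishesAbove d G → VanishesAbove e H → (G ⊛ H) (d ℕ.+ e) ≈ G d ⊗ H e
  ⊛-leading zero    zero    G H G↑ H↑ = ≈-refl
  ⊛-leading zero    (suc e) G H G↑ H↑ = begin
    G 0 ⊗ H (suc e) ⊕ (shift G ⊛ H) e ≈⟨ +-congˡ (⊛-zeroˡ H (λ i → G↑ (suc i) (s≤s z≤n)) e) ⟩
    G 0 ⊗ H (suc e) ⊕ 0#              ≈⟨ +-identityʳ _ ⟩
    G 0 ⊗ H (suc e)                   ∎
  ⊛-leading (suc d) e       G H G↑ H↑ = begin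
    G 0 ⊗ H (suc (d ℕ.+ e)) ⊕ (shift G ⊛ H) (d ℕ.+ e)
      ≈⟨ +-cong (≈-trans (*-congˡ (H↑ _ (s≤s (ℕ.m≤n+m e d)))) (zeroʳ (G 0)))
                (⊛-leading d e (shift G) H (λ i → G↑ (suc i) ∘ s≤s) H↑) ⟩
    0# ⊕ G (suc d) ⊗ H e
      ≈⟨ +-identityˡ _ ⟩
    G (suc d) ⊗ H e ∎

module _ {a b ℓ₁ ℓ₂} (R : CommutativeSemiring a ℓ₁) (S : CommutativeSemiring b ℓ₂) where
  private
    module R = CommutativeSemiring R
    module S = CommutativeSemiring S
    module ConvR = Convolution R
    module ConvS = Convolution S

  ⊛-homo : (f : R.Carrier → S.Carrier) →
           (∀ x y → f (x R.+ y) S.≈ f x S.+ f y) → (∀ x y → f (x R.* y) S.≈ f x S.* f y) →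
           ∀ G H k → f ((G ConvR.⊛ H) k) S.≈ ((f ∘ G) ConvS.⊛ (f ∘ H)) k
  ⊛-homo f f-+ f-* G H zero    = f-* (G 0) (H 0)
  ⊛-homo f f-+ f-* G H (suc k) =
    S.trans (f-+ _ _) (S.+-cong (f-* (G 0) (H (suc k))) (⊛-homo f f-+ f-* (G ∘ suc) H k))

-- Integer polynomials and Gauss's lemma

open Convolution ℤ.+-*-commutativeSemiring

HasDegreeℤ : (ℕ → ℤ) → ℕ → Set
HasDegreeℤ G d = VanishesAbove d G × G d ≢ + 0

_∣0 : ∀ P → P ℤ∣.∣ + 0
P ∣0 = ℤ∣.∣ᵤ⇒∣ (∣ P ∣ ℕ∣.∣0)

∣-⊛ : ∀ {P} G H k → (∀ j → j ≤ k → P ℤ∣.∣ H j) → P ℤ∣.∣ (G ⊛ H) k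
∣-⊛ G H zero    P∣H = ℤ∣.∣n⇒∣m*n (G 0) (P∣H 0 z≤n)
∣-⊛ G H (suc k) P∣H = ℤ∣.∣m∣n⇒∣m+n (ℤ∣.∣n⇒∣m*n (G 0) (P∣H (suc k) ℕ.≤-refl))
  (∣-⊛ (shift G) H k (λ j j≤k → P∣H j (ℕ.m≤n⇒m≤1+n j≤k)))

⊛≡*-mod : ∀ {P} i j G H → (∀ i′ → i′ < i → P ℤ∣.∣ G i′) → (∀ j′ → j′ < j → P ℤ∣.∣ H j′) →
          P ℤ∣.∣ (G ⊛ H) (i ℕ.+ j) - G i * H j
⊛≡*-mod {P} zero zero G H _ _ = subst (P ℤ∣.∣_) (sym (ℤ.+-inverseʳ (G 0 * H 0))) (P ∣0)
⊛≡*-mod {P} zero (suc j) G H _ P∣H = subst (P ℤ∣.∣_) (sym ([a+x]-a≡x (G 0 * H (suc j)) _))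
  (∣-⊛ (shift G) H j (λ j′ j′≤j → P∣H j′ (s≤s j′≤j)))
  where
  [a+x]-a≡x : ∀ a x → (a + x) - a ≡ x
  [a+x]-a≡x = solve-∀
⊛≡*-mod {P} (suc i) j G H P∣G P∣H = subst (P ℤ∣.∣_) (sym ([a+x]-y≡a+[x-y] (G 0 * H (suc (i ℕ.+ j))) _ _))
  (ℤ∣.∣m∣n⇒∣m+n (ℤ∣.∣m⇒∣m*n _ (P∣G 0 (s≤s z≤n)))
                (⊛≡*-mod i j (shift G) H (λ i′ i′<i → P∣G (suc i′) (s≤s i′<i)) P∣H))
  where
  [a+x]-y≡a+[x-y] : ∀ a x y → (a + x) - y ≡ a + (x - y)
  [a+x]-y≡a+[x-y] = solve-∀

divides-all-or-least-exception : ∀ P d G → VanishesAbove d G →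
  (∀ i → P ℤ∣.∣ G i) ⊎ ∃[ i ] ((∀ i′ → i′ < i → P ℤ∣.∣ G i′) × ¬ P ℤ∣.∣ G i)
divides-all-or-least-exception P d G G↑ with search (suc d)
  where
  search : ∀ n → (∀ i → i < n → P ℤ∣.∣ G i) ⊎ ∃[ i ] ((∀ i′ → i′ < i → P ℤ∣.∣ G i′) × ¬ P ℤ∣.∣ G i)
  search zero = inj₁ (λ _ ())
  search (suc n) with search n | P ℤ∣.∣? G n
  ... | inj₂ least        | _          = inj₂ least
  ... | inj₁ P∣G<n        | no  P∤Gn   = inj₂ (n , P∣G<n , P∤Gn)
  ... | inj₁ P∣G<n        | yes P∣Gn   = inj₁ λ i i<1+n → [ P∣G<n i , (λ { refl → P∣Gn }) ]′ (ℕ.m<1+n⇒m<n∨m≡n i<1+n)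
... | inj₂ least = inj₂ least
... | inj₁ P∣G≤d = inj₁ λ i → case i ℕ.≤? d of λ
  { (yes i≤d) → P∣G≤d i (s≤s i≤d)
  ; (no  i≰d) → subst (P ℤ∣.∣_) (sym (G↑ i (ℕ.≰⇒> i≰d))) (P ∣0) }

gauss-prime : ∀ {p} → Prime p → ∀ d e G H → VanishesAbove d G → VanishesAbove e H →
              (∀ k → + p ℤ∣.∣ (G ⊛ H) k) → (∀ i → + p ℤ∣.∣ G i) ⊎ (∀ j → + p ℤ∣.∣ H j)
gauss-prime {p} p-prime d e G H G↑ H↑ p∣GH
  with divides-all-or-least-exception (+ p) d G G↑ | divides-all-or-least-exception (+ p) e H H↑
... | inj₁ p∣G | _ = inj₁ p∣G
... | inj₂ _ | inj₁ p∣H = inj₂ p∣H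
... | inj₂ (i , p∣G<i , p∤Gi) | inj₂ (j , p∣H<j , p∤Hj) =
  ⊥-elim ([ p∤Gi ∘ ℤ∣.∣ᵤ⇒∣ , p∤Hj ∘ ℤ∣.∣ᵤ⇒∣ ]′ (euclidsLemma ∣ G i ∣ ∣ H j ∣ p-prime p∣∣GiHj∣))
  where
  p∣GiHj : + p ℤ∣.∣ G i * H j
  p∣GiHj = subst (+ p ℤ∣.∣_) (x-[x-y]≡y ((G ⊛ H) (i ℕ.+ j)) (G i * H j))
    (ℤ∣.∣m∣n⇒∣m-n (p∣GH (i ℕ.+ j)) (⊛≡*-mod i j G H p∣G<i p∣H<j))
    where
    x-[x-y]≡y : ∀ x y → x - (x - y) ≡ y
    x-[x-y]≡y = solve-∀
  p∣∣GiHj∣ : p ℕ∣.∣ ∣ G i ∣ ℕ.* ∣ H j ∣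
  p∣∣GiHj∣ = subst (p ℕ∣.∣_) (ℤ.abs-* (G i) (H j)) (ℤ∣.∣⇒∣ᵤ p∣GiHj)

⊛-degree : ∀ {G H d e} → HasDegreeℤ G d → HasDegreeℤ H e → HasDegreeℤ (G ⊛ H) (d ℕ.+ e)
⊛-degree {G} {H} {d} {e} (G↑ , Gd≢0) (H↑ , He≢0) = ⊛-vanishesAbove d e G H G↑ H↑ , λ GH[d+e]≡0 →
  [ Gd≢0 , He≢0 ]′ (ℤ.i*j≡0⇒i≡0∨j≡0 (G d) (trans (sym (⊛-leading d e G H G↑ H↑)) GH[d+e]≡0))

degree-unique : ∀ {F F′ m n} → F ≗ F′ → HasDegreeℤ F m → HasDegreeℤ F′ n → m ≡ n
degree-unique {F} {F′} {m} {n} F≗F′ (F↑ , Fm≢0) (F′↑ , F′n≢0) with ℕ.<-cmp m n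
... | tri< m<n _ _ = ⊥-elim (F′n≢0 (trans (sym (F≗F′ n)) (F↑ n m<n)))
... | tri≈ _ m≡n _ = m≡n
... | tri> _ _ n<m = ⊥-elim (Fm≢0 (trans (F≗F′ m) (F′↑ m n<m)))

record ScaledFactorisation (K : ℤ) (F : ℕ → ℤ) (d e : ℕ) : Set where
  field
    left right   : ℕ → ℤ
    left-degree  : HasDegreeℤ left d
    right-degree : HasDegreeℤ right e
    is-product   : left ⊛ right ≗ λ k → K * F k

+p≢0 : ∀ {p} → Prime p → + p ≢ + 0
+p≢0 {p} p-prime = ℕ.≢-nonZero⁻¹ p {{prime⇒nonZero p-prime}} ∘ ℤ.+-injective

divide-by-prime : ∀ {p G d} → Prime p → HasDegreeℤ G d → (∀ i → + p ℤ∣.∣ G i) →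
                  ∃[ G′ ] HasDegreeℤ G′ d × G ≗ (λ i → + p * G′ i)
divide-by-prime {p} {G} {d} p-prime (G↑ , Gd≢0) p∣G = G′ , (G′↑ , G′d≢0) , G≡pG′
  where
  G′ : ℕ → ℤ
  G′ i = ℤ∣._∣_.quotient (p∣G i)
  G≡pG′ : G ≗ (λ i → + p * G′ i)
  G≡pG′ i = trans (ℤ∣._∣_.equality (p∣G i)) (ℤ.*-comm (G′ i) (+ p))
  G′↑ : VanishesAbove d G′
  G′↑ i d<i = [ (λ p≡0 → ⊥-elim (+p≢0 p-prime p≡0)) , (λ G′i≡0 → G′i≡0) ]′
    (ℤ.i*j≡0⇒i≡0∨j≡0 (+ p) (trans (sym (G≡pG′ i)) (G↑ i d<i)))
  G′d≢0 : G′ d ≢ + 0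
  G′d≢0 G′d≡0 = Gd≢0 (trans (G≡pG′ d) (trans (cong (+ p *_) G′d≡0) (ℤ.*-zeroʳ (+ p))))

module _ {p K F d e} (p-prime : Prime p) (φ : ScaledFactorisation (+ p * K) F d e) where
  open ScaledFactorisation φ

  private
    cancel-p : ∀ {x} y → + p * x ≡ + p * K * y → x ≡ K * y
    cancel-p {x} y eq = ℤ.*-cancelˡ-≡ (+ p) x (K * y) {{prime⇒nonZero p-prime}} (trans eq (ℤ.*-assoc (+ p) K y))

  cancel-primeˡ : (∀ i → + p ℤ∣.∣ left i) → ScaledFactorisation K F d e
  cancel-primeˡ p∣left with divide-by-prime p-prime left-degree p∣left
  ... | G′ , G′-degree , left≡pG′ = record
    { left = G′ ; right = right ; left-degree = G′-degree ; right-degree = right-degree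
    ; is-product = λ k → cancel-p (F k) (begin
        + p * (G′ ⊛ right) k           ≡⟨ sym (⊛-scaleˡ (+ p) G′ right k) ⟩
        ((λ i → + p * G′ i) ⊛ right) k ≡⟨ sym (⊛-cong left≡pG′ (λ _ → refl) k) ⟩
        (left ⊛ right) k               ≡⟨ is-product k ⟩
        + p * K * F k                  ∎) }
    where open ≡-Reasoning

  cancel-primeʳ : (∀ j → + p ℤ∣.∣ right j) → ScaledFactorisation K F d e
  cancel-primeʳ p∣right with divide-by-prime p-prime right-degree p∣right
  ... | H′ , H′-degree , right≡pH′ = record
    { left = left ; right = H′ ; left-degree = left-degree ; right-degree = H′-degree
    ; is-product = λ k → cancel-p (F k) (begin
        + p * (left ⊛ H′) k            ≡⟨ sym (⊛-scaleʳ (+ p) left H′ k) ⟩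
        (left ⊛ (λ i → + p * H′ i)) k  ≡⟨ sym (⊛-cong (λ _ → refl) right≡pH′ k) ⟩
        (left ⊛ right) k               ≡⟨ is-product k ⟩
        + p * K * F k                  ∎) }
    where open ≡-Reasoning

  cancel-prime : ScaledFactorisation K F d e
  cancel-prime = [ cancel-primeˡ , cancel-primeʳ ]′
    (gauss-prime p-prime d e left right (proj₁ left-degree) (proj₁ right-degree) p∣product)
    where
    p∣product : ∀ k → + p ℤ∣.∣ (left ⊛ right) k
    p∣product k = ℤ∣.divides (K * F k) (trans (is-product k) (abx≡bx*a (+ p) K (F k)))
      where
      abx≡bx*a : ∀ a b x → a * b * x ≡ b * x * a
      abx≡bx*a = solve-∀

cancel-scalar : ∀ {F d e} K .{{_ : ℕ.NonZero K}} → ScaledFactorisation (+ K) F d e → ScaledFactorisation (+ 1) F d e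
cancel-scalar {F} {d} {e} K φ = cancel-primes (factors K!) (factorsPrime K!)
  (subst (λ n → ScaledFactorisation (+ n) F d e) (isFactorisation K!) φ)
  where
  open PrimeFactorisation
  K! : PrimeFactorisation K
  K! = factorise K
  cancel-primes : ∀ ps → All Prime ps → ScaledFactorisation (+ product ps) F d e → ScaledFactorisation (+ 1) F d e
  cancel-primes []       []                 φ = φ
  cancel-primes (p ∷ ps) (p-prime ∷ primes) φ = cancel-primes ps primes
    (cancel-prime p-prime (subst (λ n → ScaledFactorisation n F d e) (ℤ.pos-* p (product ps)) φ))

-- Clearing denominators

ℚ-commutativeSemiring : CommutativeSemiring _ _
ℚ-commutativeSemiring = CommutativeRing.commutativeSemiring ℚ.+-*-commutativeRing

module ℚ⊛ = Convolution ℚ-commutativeSemiring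
open +-*-Solver using (solve; _:*_; _:=_)

toℚ≡fromℤ : ∀ z → toℚ z ≡ fromℤ z
toℚ≡fromℤ z = ℚ.↥p/↧p≡p (fromℤ z)

toℚ-injective : ∀ {x y} → toℚ x ≡ toℚ y → x ≡ y
toℚ-injective {x} {y} eq = cong ℚ.↥_ (trans (sym (toℚ≡fromℤ x)) (trans eq (toℚ≡fromℤ y)))

toℚ-+ : ∀ x y → toℚ (x + y) ≡ toℚ x ℚ.+ toℚ y
toℚ-+ x y rewrite toℚ≡fromℤ x | toℚ≡fromℤ y =
  cong (ℚ._/ 1) (sym (cong₂ _+_ (ℤ.*-identityʳ x) (ℤ.*-identityʳ y)))

toℚ-* : ∀ x y → toℚ (x * y) ≡ toℚ x ℚ.* toℚ y
toℚ-* x y rewrite toℚ≡fromℤ x | toℚ≡fromℤ y = refl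

toℚ-pos-* : ∀ m n → toℚ (+ (m ℕ.* n)) ≡ toℚ (+ m) ℚ.* toℚ (+ n)
toℚ-pos-* m n = trans (cong toℚ (ℤ.pos-* m n)) (toℚ-* (+ m) (+ n))

toℚ-⊛ : ∀ G H → toℚ ∘ (G ⊛ H) ≗ (toℚ ∘ G) ℚ⊛.⊛ (toℚ ∘ H)
toℚ-⊛ = ⊛-homo ℤ.+-*-commutativeSemiring ℚ-commutativeSemiring toℚ toℚ-+ toℚ-*

conv≗⊛ : ∀ g h → conv g h ≗ coeff g ℚ⊛.⊛ coeff h
conv≗⊛ []      h k       = sym (ℚ⊛.⊛-zeroˡ (coeff h) (λ _ → refl) k)
conv≗⊛ (a ∷ g) h zero    = refl
conv≗⊛ (a ∷ g) h (suc k) = cong (a ℚ.* coeff h (suc k) ℚ.+_) (conv≗⊛ g h k)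

toℚ[↥q]≡↧q*q : ∀ q → toℚ (ℚ.↥ q) ≡ toℚ (+ ℚ.↧ₙ q) ℚ.* q
toℚ[↥q]≡↧q*q q@(ℚ.mkℚ n d-1 _) rewrite toℚ≡fromℤ n | toℚ≡fromℤ (+ suc d-1) =
  ℚ.toℚᵘ-injective (ℚᵘ.≃-trans (ℚᵘ.*≡* n*d≡d*n*1) (ℚᵘ.≃-sym (ℚ.toℚᵘ-homo-* (fromℤ (+ suc d-1)) q)))
  where
  n*d≡d*n*1 : n * + suc (d-1 ℕ.+ 0) ≡ + suc d-1 * n * + 1
  n*d≡d*n*1 rewrite ℕ.+-identityʳ d-1 = ax≡xa1 n (+ suc d-1)
    where
    ax≡xa1 : ∀ a x → a * x ≡ x * a * + 1
    ax≡xa1 = solve-∀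

N*p≡0⇒p≡0 : ∀ N .{{_ : ℕ.NonZero N}} p → toℚ (+ N) ℚ.* p ≡ 0ℚ → p ≡ 0ℚ
N*p≡0⇒p≡0 N p Np≡0 rewrite toℚ≡fromℤ (+ N) = begin
  p                    ≡⟨ sym (ℚ.*-identityˡ p) ⟩
  1ℚ ℚ.* p             ≡⟨ cong (ℚ._* p) (sym (ℚ.*-inverseˡ N′)) ⟩
  ℚ.1/ N′ ℚ.* N′ ℚ.* p   ≡⟨ ℚ.*-assoc (ℚ.1/ N′) N′ p ⟩
  ℚ.1/ N′ ℚ.* (N′ ℚ.* p) ≡⟨ cong (ℚ.1/ N′ ℚ.*_) Np≡0 ⟩
  ℚ.1/ N′ ℚ.* 0ℚ        ≡⟨ ℚ.*-zeroʳ (ℚ.1/ N′) ⟩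
  0ℚ                   ∎
  where
  open ≡-Reasoning
  N′ : ℚ
  N′ = fromℤ (+ N)

denominatorProduct : Poly → ℕ
denominatorProduct []      = 1
denominatorProduct (q ∷ g) = denominatorProduct g ℕ.* ℚ.↧ₙ q

denominatorProduct-nonZero : ∀ g → ℕ.NonZero (denominatorProduct g)
denominatorProduct-nonZero []                = _
denominatorProduct-nonZero (ℚ.mkℚ _ _ _ ∷ g) = ℕ.m*n≢0 (denominatorProduct g) _ {{denominatorProduct-nonZero g}}

cleared : Poly → ℕ → ℤ
cleared []      _       = + 0
cleared (q ∷ g) zero    = ℚ.↥ q * + denominatorProduct g
cleared (q ∷ g) (suc i) = cleared g i * + ℚ.↧ₙ q

cleared-coeff : ∀ g i → toℚ (cleared g i) ≡ toℚ (+ denominatorProduct g) ℚ.* coeff g i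
cleared-coeff [] i = refl
cleared-coeff (q ∷ g) zero = begin
  toℚ (ℚ.↥ q * + D)                        ≡⟨ toℚ-* (ℚ.↥ q) (+ D) ⟩
  toℚ (ℚ.↥ q) ℚ.* toℚ (+ D)                ≡⟨ cong (ℚ._* toℚ (+ D)) (toℚ[↥q]≡↧q*q q) ⟩
  toℚ (+ ℚ.↧ₙ q) ℚ.* q ℚ.* toℚ (+ D)       ≡⟨ x*y*z≡z*x*y (toℚ (+ ℚ.↧ₙ q)) q (toℚ (+ D)) ⟩
  toℚ (+ D) ℚ.* toℚ (+ ℚ.↧ₙ q) ℚ.* q       ≡⟨ cong (ℚ._* q) (sym (toℚ-pos-* D (ℚ.↧ₙ q))) ⟩
  toℚ (+ (D ℕ.* ℚ.↧ₙ q)) ℚ.* q             ∎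
  where
  open ≡-Reasoning
  D : ℕ
  D = denominatorProduct g
  x*y*z≡z*x*y : ∀ x y z → x ℚ.* y ℚ.* z ≡ z ℚ.* x ℚ.* y
  x*y*z≡z*x*y x y z = solve 3 (λ x y z → x :* y :* z := z :* x :* y) refl x y z
cleared-coeff (q ∷ g) (suc i) = begin
  toℚ (cleared g i * + ℚ.↧ₙ q)                  ≡⟨ toℚ-* (cleared g i) (+ ℚ.↧ₙ q) ⟩
  toℚ (cleared g i) ℚ.* toℚ (+ ℚ.↧ₙ q)          ≡⟨ cong (ℚ._* toℚ (+ ℚ.↧ₙ q)) (cleared-coeff g i) ⟩
  toℚ (+ D) ℚ.* coeff g i ℚ.* toℚ (+ ℚ.↧ₙ q)    ≡⟨ x*y*z≡x*z*y (toℚ (+ D)) (coeff g i) (toℚ (+ ℚ.↧ₙ q)) ⟩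
  toℚ (+ D) ℚ.* toℚ (+ ℚ.↧ₙ q) ℚ.* coeff g i    ≡⟨ cong (ℚ._* coeff g i) (sym (toℚ-pos-* D (ℚ.↧ₙ q))) ⟩
  toℚ (+ (D ℕ.* ℚ.↧ₙ q)) ℚ.* coeff g i          ∎
  where
  open ≡-Reasoning
  D : ℕ
  D = denominatorProduct g
  x*y*z≡x*z*y : ∀ x y z → x ℚ.* y ℚ.* z ≡ x ℚ.* z ℚ.* y
  x*y*z≡x*z*y x y z = solve 3 (λ x y z → x :* y :* z := x :* z :* y) refl x y z

cleared-degree : ∀ g {d} → HasDegree g d → HasDegreeℤ (cleared g) d
cleared-degree g {d} (gd≢0 , g↑) = cleared↑ , cleared-d≢0
  where
  D : ℕ
  D = denominatorProduct g
  cleared↑ : VanishesAbove d (cleared g)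
  cleared↑ i d<i = toℚ-injective (begin
    toℚ (cleared g i)         ≡⟨ cleared-coeff g i ⟩
    toℚ (+ D) ℚ.* coeff g i   ≡⟨ cong (toℚ (+ D) ℚ.*_) (g↑ i d<i) ⟩
    toℚ (+ D) ℚ.* 0ℚ          ≡⟨ ℚ.*-zeroʳ (toℚ (+ D)) ⟩
    0ℚ                        ∎)
    where open ≡-Reasoning
  cleared-d≢0 : cleared g d ≢ + 0
  cleared-d≢0 cleared-d≡0 = gd≢0 (N*p≡0⇒p≡0 D {{denominatorProduct-nonZero g}} (coeff g d)
    (trans (sym (cleared-coeff g d)) (cong toℚ cleared-d≡0)))

cleared-⊛ : ∀ g h k → toℚ ((cleared g ⊛ cleared h) k) ≡
  toℚ (+ (denominatorProduct g ℕ.* denominatorProduct h)) ℚ.* conv g h k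
cleared-⊛ g h k = begin
  toℚ ((cleared g ⊛ cleared h) k)
    ≡⟨ toℚ-⊛ (cleared g) (cleared h) k ⟩
  ((toℚ ∘ cleared g) ℚ⊛.⊛ (toℚ ∘ cleared h)) k
    ≡⟨ ℚ⊛.⊛-cong (cleared-coeff g) (cleared-coeff h) k ⟩
  ((λ i → Dg ℚ.* coeff g i) ℚ⊛.⊛ (λ j → Dh ℚ.* coeff h j)) k
    ≡⟨ ℚ⊛.⊛-scaleˡ Dg (coeff g) _ k ⟩
  Dg ℚ.* (coeff g ℚ⊛.⊛ (λ j → Dh ℚ.* coeff h j)) k
    ≡⟨ cong (Dg ℚ.*_) (ℚ⊛.⊛-scaleʳ Dh (coeff g) (coeff h) k) ⟩
  Dg ℚ.* (Dh ℚ.* (coeff g ℚ⊛.⊛ coeff h) k)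
    ≡⟨ sym (ℚ.*-assoc Dg Dh _) ⟩
  Dg ℚ.* Dh ℚ.* (coeff g ℚ⊛.⊛ coeff h) k
    ≡⟨ cong₂ ℚ._*_ (sym (toℚ-pos-* (denominatorProduct g) (denominatorProduct h))) (sym (conv≗⊛ g h k)) ⟩
  toℚ (+ (denominatorProduct g ℕ.* denominatorProduct h)) ℚ.* conv g h k ∎
  where
  open ≡-Reasoning
  Dg Dh : ℚ
  Dg = toℚ (+ denominatorProduct g)
  Dh = toℚ (+ denominatorProduct h)

reducible⇒integral-factorisation : ∀ {f F} → coeff f ≗ toℚ ∘ F → ReducibleQ f →
  ∃[ d ] ∃[ e ] 1 ≤ d × 1 ≤ e × ScaledFactorisation (+ 1) F d e
reducible⇒integral-factorisation {f} {F} f≗F (g , h , d , e , g-degree , h-degree , 1≤d , 1≤e , f≗gh) =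
  d , e , 1≤d , 1≤e , cancel-scalar D {{D≢0}} record
    { left = cleared g ; right = cleared h
    ; left-degree = cleared-degree g g-degree ; right-degree = cleared-degree h h-degree
    ; is-product = λ k → toℚ-injective (begin
        toℚ ((cleared g ⊛ cleared h) k) ≡⟨ cleared-⊛ g h k ⟩
        toℚ (+ D) ℚ.* conv g h k         ≡⟨ cong (toℚ (+ D) ℚ.*_) (trans (sym (f≗gh k)) (f≗F k)) ⟩
        toℚ (+ D) ℚ.* toℚ (F k)          ≡⟨ sym (toℚ-* (+ D) (F k)) ⟩
        toℚ (+ D * F k)                  ∎) }
  where
  open ≡-Reasoning
  D : ℕ
  D = denominatorProduct g ℕ.* denominatorProduct h
  D≢0 : ℕ.NonZero D
  D≢0 = ℕ.m*n≢0 _ _ {{denominatorProduct-nonZero g}} {{denominatorProduct-nonZero h}}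

-- Parity

bit : Bool → ℤ
bit false = + 0
bit true  = + 1

infix 4 _≡₂_
record _≡₂_ (x : ℤ) (b : Bool) : Set where
  constructor mod2
  field
    half  : ℤ
    equal : x ≡ bit b + half * + 2

odd≢even : ∀ q r → + 1 + q * + 2 ≢ + 0 + r * + 2
odd≢even q r eq = case ℕ∣.∣1⇒≡1 (ℤ∣.∣⇒∣ᵤ 2∣1) of λ ()
  where
  2∣1 : + 2 ℤ∣.∣ + 1
  2∣1 = ℤ∣.divides (r - q) (begin
    + 1                       ≡⟨ sym (1+2q-2q≡1 q) ⟩
    + 1 + q * + 2 - q * + 2   ≡⟨ cong (_- q * + 2) eq ⟩
    + 0 + r * + 2 - q * + 2   ≡⟨ 0+2r-2q≡[r-q]*2 r q ⟩
    (r - q) * + 2             ∎)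
    where
    open ≡-Reasoning
    1+2q-2q≡1 : ∀ q → + 1 + q * + 2 - q * + 2 ≡ + 1
    1+2q-2q≡1 = solve-∀
    0+2r-2q≡[r-q]*2 : ∀ r q → + 0 + r * + 2 - q * + 2 ≡ (r - q) * + 2
    0+2r-2q≡[r-q]*2 = solve-∀

≡₂-unique : ∀ {x b c} → x ≡₂ b → x ≡₂ c → b ≡ c
≡₂-unique {b = false} {false} _        _        = refl
≡₂-unique {b = true}  {true}  _        _        = refl
≡₂-unique {b = false} {true}  (mod2 q eq) (mod2 r eq′) = ⊥-elim (odd≢even r q (trans (sym eq′) eq))
≡₂-unique {b = true}  {false} (mod2 q eq) (mod2 r eq′) = ⊥-elim (odd≢even q r (trans (sym eq) eq′))

≡₂-+ : ∀ {x y b c} → x ≡₂ b → y ≡₂ c → x + y ≡₂ b xor c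
≡₂-+ {b = false} {false} (mod2 q refl) (mod2 r refl) = mod2 (q + r) (ff q r)
  where
  ff : ∀ q r → + 0 + q * + 2 + (+ 0 + r * + 2) ≡ + 0 + (q + r) * + 2
  ff = solve-∀
≡₂-+ {b = false} {true}  (mod2 q refl) (mod2 r refl) = mod2 (q + r) (ft q r)
  where
  ft : ∀ q r → + 0 + q * + 2 + (+ 1 + r * + 2) ≡ + 1 + (q + r) * + 2
  ft = solve-∀
≡₂-+ {b = true}  {false} (mod2 q refl) (mod2 r refl) = mod2 (q + r) (tf q r)
  where
  tf : ∀ q r → + 1 + q * + 2 + (+ 0 + r * + 2) ≡ + 1 + (q + r) * + 2
  tf = solve-∀
≡₂-+ {b = true}  {true}  (mod2 q refl) (mod2 r refl) = mod2 (q + r + + 1) (tt q r)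
  where
  tt : ∀ q r → + 1 + q * + 2 + (+ 1 + r * + 2) ≡ + 0 + (q + r + + 1) * + 2
  tt = solve-∀

≡₂-* : ∀ {x y b c} → x ≡₂ b → y ≡₂ c → x * y ≡₂ b ∧ c
≡₂-* {b = false} {false} (mod2 q refl) (mod2 r refl) = mod2 (q * r * + 2) (ff q r)
  where
  ff : ∀ q r → (+ 0 + q * + 2) * (+ 0 + r * + 2) ≡ + 0 + q * r * + 2 * + 2
  ff = solve-∀
≡₂-* {b = false} {true}  (mod2 q refl) (mod2 r refl) = mod2 (q + q * r * + 2) (ft q r)
  where
  ft : ∀ q r → (+ 0 + q * + 2) * (+ 1 + r * + 2) ≡ + 0 + (q + q * r * + 2) * + 2
  ft = solve-∀
≡₂-* {b = true}  {false} (mod2 q refl) (mod2 r refl) = mod2 (r + q * r * + 2) (tf q r)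
  where
  tf : ∀ q r → (+ 1 + q * + 2) * (+ 0 + r * + 2) ≡ + 0 + (r + q * r * + 2) * + 2
  tf = solve-∀
≡₂-* {b = true}  {true}  (mod2 q refl) (mod2 r refl) = mod2 (q + r + q * r * + 2) (tt q r)
  where
  tt : ∀ q r → (+ 1 + q * + 2) * (+ 1 + r * + 2) ≡ + 1 + (q + r + q * r * + 2) * + 2
  tt = solve-∀

remainder-mod-2 : ∀ x → ∃[ b ] x ≡₂ b
remainder-mod-2 x = bit-of (x % + 2) (x / + 2) (n%d<d x (+ 2)) (a≡a%n+[a/n]*n x (+ 2))
  where
  bit-of : ∀ r q → r < 2 → x ≡ + r + q * + 2 → ∃[ b ] x ≡₂ b
  bit-of 0 q _ eq = false , mod2 q eq
  bit-of 1 q _ eq = true  , mod2 q eq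
  bit-of (suc (suc _)) _ (s≤s (s≤s ())) _

parity : ℤ → Bool
parity x = proj₁ (remainder-mod-2 x)

≡₂-parity : ∀ x → x ≡₂ parity x
≡₂-parity x = proj₂ (remainder-mod-2 x)

parity-unique : ∀ {x b} → x ≡₂ b → parity x ≡ b
parity-unique {x} = ≡₂-unique (proj₂ (remainder-mod-2 x))

parity-+ : ∀ x y → parity (x + y) ≡ parity x xor parity y
parity-+ x y = parity-unique (≡₂-+ (proj₂ (remainder-mod-2 x)) (proj₂ (remainder-mod-2 y)))

parity-* : ∀ x y → parity (x * y) ≡ parity x ∧ parity y
parity-* x y = parity-unique (≡₂-* (proj₂ (remainder-mod-2 x)) (proj₂ (remainder-mod-2 y)))

odd⇒≢0 : ∀ {x} → x ≡₂ true → x ≢ + 0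
odd⇒≢0 (mod2 q x≡1+2q) x≡0 = odd≢even q (+ 0) (trans (sym x≡1+2q) x≡0)

n[n+1]-even : ∀ n → n * (n + + 1) ≡₂ false
n[n+1]-even n with parity n | ≡₂-parity n
... | false | n-even = ≡₂-* n-even (≡₂-+ n-even (≡₂-parity (+ 1)))
... | true  | n-odd  = ≡₂-* n-odd  (≡₂-+ n-odd  (≡₂-parity (+ 1)))

4∣x-1⇒odd : ∀ {x} → + 4 ∣ (x - + 1) → x ≡₂ true
4∣x-1⇒odd {x} 4∣x-1 with ℤ∣.∣ᵤ⇒∣ {+ 4} {x - + 1} 4∣x-1
... | ℤ∣.divides k x-1≡4k = mod2 (k * + 2) (begin
  x                   ≡⟨ x≡[x-1]+1 x ⟩
  (x - + 1) + + 1     ≡⟨ cong (_+ + 1) x-1≡4k ⟩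
  k * + 4 + + 1       ≡⟨ 4k+1≡1+2k*2 k ⟩
  + 1 + k * + 2 * + 2 ∎)
  where
  open ≡-Reasoning
  x≡[x-1]+1 : ∀ x → x ≡ (x - + 1) + + 1
  x≡[x-1]+1 = solve-∀
  4k+1≡1+2k*2 : ∀ k → k * + 4 + + 1 ≡ + 1 + k * + 2 * + 2
  4k+1≡1+2k*2 = solve-∀

lookupOr : ∀ {A : Set} → A → List A → ℕ → A
lookupOr z []      _       = z
lookupOr z (a ∷ l) zero    = a
lookupOr z (a ∷ l) (suc i) = lookupOr z l i

lookupOr-map : ∀ {A B : Set} (f : A → B) z l → f ∘ lookupOr z l ≗ lookupOr (f z) (List.map f l)
lookupOr-map f z []      i       = refl
lookupOr-map f z (a ∷ l) zero    = refl
lookupOr-map f z (a ∷ l) (suc i) = lookupOr-map f z l i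

lookupOr-beyond : ∀ {A : Set} (z : A) l i → List.length l ≤ i → lookupOr z l i ≡ z
lookupOr-beyond z []      i       _         = refl
lookupOr-beyond z (a ∷ l) (suc i) (s≤s l≤i) = lookupOr-beyond z l i l≤i

lookupOr-applyUpTo : ∀ {A : Set} (z : A) β n → (∀ i → n ≤ i → β i ≡ z) → lookupOr z (List.applyUpTo β n) ≗ β
lookupOr-applyUpTo z β zero    β↑ i       = sym (β↑ i z≤n)
lookupOr-applyUpTo z β (suc n) β↑ zero    = refl
lookupOr-applyUpTo z β (suc n) β↑ (suc i) = lookupOr-applyUpTo z (β ∘ suc) n (λ i n≤i → β↑ (suc i) (s≤s n≤i)) i

octicCoefficients : ℤ → ℤ → List ℤ
octicCoefficients A B = + 1 ∷ + 0 ∷ A ∷ + 0 ∷ B ∷ + 0 ∷ A ∷ + 0 ∷ + 1 ∷ []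

octic : ℤ → ℤ → ℕ → ℤ
octic A B = lookupOr (+ 0) (octicCoefficients A B)

coeff≗lookupOr : ∀ p → coeff p ≗ lookupOr 0ℚ p
coeff≗lookupOr []      i       = refl
coeff≗lookupOr (a ∷ p) zero    = refl
coeff≗lookupOr (a ∷ p) (suc i) = coeff≗lookupOr p i

coeff-map-toℚ : ∀ l → coeff (List.map toℚ l) ≗ toℚ ∘ lookupOr (+ 0) l
coeff-map-toℚ l i = trans (coeff≗lookupOr (List.map toℚ l) i) (sym (lookupOr-map toℚ (+ 0) l i))

coeff-F3 : ∀ A B → coeff (F3 A B) ≗ toℚ ∘ octic A B
coeff-F3 A B = coeff-map-toℚ (octicCoefficients A B)

octic-degree : ∀ A B → HasDegreeℤ (octic A B) 8
octic-degree A B = lookupOr-beyond (+ 0) (octicCoefficients A B) , λ ()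

-- Reduction modulo 2

𝔽₂-commutativeSemiring : CommutativeSemiring _ _
𝔽₂-commutativeSemiring = CommutativeRing.commutativeSemiring xor-∧-commutativeRing

module 𝔽₂⊛ = Convolution 𝔽₂-commutativeSemiring

parity-⊛ : ∀ G H → parity ∘ (G ⊛ H) ≗ (parity ∘ G) 𝔽₂⊛.⊛ (parity ∘ H)
parity-⊛ = ⊛-homo ℤ.+-*-commutativeSemiring 𝔽₂-commutativeSemiring parity parity-+ parity-*

octic₂ : ℕ → Bool
octic₂ = lookupOr false (true ∷ false ∷ true ∷ false ∷ true ∷ false ∷ true ∷ false ∷ true ∷ [])

parity-octic : ∀ {A B} → A ≡₂ true → B ≡₂ true → parity ∘ octic A B ≗ octic₂
parity-octic {A} {B} A-odd B-odd i
  rewrite lookupOr-map parity (+ 0) (octicCoefficients A B) i | parity-unique A-odd | parity-unique B-odd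
  = refl

∀-bits : ℕ → (List Bool → Bool) → Bool
∀-bits zero    P = P []
∀-bits (suc n) P = ∀-bits n (P ∘ (true ∷_)) ∧ ∀-bits n (P ∘ (false ∷_))

∀-bits-sound : ∀ n P → T (∀-bits n P) → ∀ β → T (P (List.applyUpTo β n))
∀-bits-sound zero    P h β = h
∀-bits-sound (suc n) P h β with β 0 | Equivalence.to (T-∧ {∀-bits n (P ∘ (true ∷_))} {∀-bits n (P ∘ (false ∷_))}) h
... | true  | h₁ , _ = ∀-bits-sound n (P ∘ (true ∷_)) h₁ (β ∘ suc)
... | false | _ , h₂ = ∀-bits-sound n (P ∘ (false ∷_)) h₂ (β ∘ suc)

T-and-applyUpTo⁺ : ∀ p n → (∀ k → T (p k)) → T (and (List.applyUpTo p n))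
T-and-applyUpTo⁺ p zero    Tp = _
T-and-applyUpTo⁺ p (suc n) Tp = Equivalence.from T-∧ (Tp 0 , T-and-applyUpTo⁺ (p ∘ suc) n (Tp ∘ suc))

T-and-applyUpTo⁻ : ∀ p n → T (and (List.applyUpTo p n)) → ∀ k → k < n → T (p k)
T-and-applyUpTo⁻ p (suc n) T∧ zero    _         = proj₁ (Equivalence.to (T-∧ {p 0}) T∧)
T-and-applyUpTo⁻ p (suc n) T∧ (suc k) (s≤s k<n) =
  T-and-applyUpTo⁻ (p ∘ suc) n (proj₂ (Equivalence.to (T-∧ {p 0}) T∧)) k k<n

agreeUpTo : ℕ → (ℕ → Bool) → (ℕ → Bool) → Bool
agreeUpTo n f g = and (List.applyUpTo (λ k → ⌊ f k Bool.≟ g k ⌋) (suc n))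

-- T (mod2-verdict d e): whenever l₁ · l₂ = octic₂ over 𝔽₂ with deg l₁ ≤ d and deg l₂ ≤ e, then d = 4 and
-- l₁ = x⁴ + x³ + x² + x + 1. It is decided by evaluation for every split d + e = 8.
product-forces-shape : ℕ → List Bool → List Bool → Bool
product-forces-shape d l₁ l₂ =
  not (agreeUpTo 8 (lookupOr false l₁ 𝔽₂⊛.⊛ lookupOr false l₂) octic₂) ∨ ((d ℕ.≡ᵇ 4) ∧ and l₁)

mod2-verdict : ℕ → ℕ → Bool
mod2-verdict d e = ∀-bits (suc d) λ l₁ → ∀-bits (suc e) (product-forces-shape d l₁)

mod2-verdict-holds : ∀ d e → 1 ≤ d → 1 ≤ e → d ℕ.+ e ≡ 8 → T (mod2-verdict d e)
mod2-verdict-holds 1 _ _ _ refl = _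
mod2-verdict-holds 2 _ _ _ refl = _
mod2-verdict-holds 3 _ _ _ refl = _
mod2-verdict-holds 4 _ _ _ refl = _
mod2-verdict-holds 5 _ _ _ refl = _
mod2-verdict-holds 6 _ _ _ refl = _
mod2-verdict-holds 7 _ _ _ refl = _
mod2-verdict-holds 8 0 _ () _

mod2-factor-shape : ∀ {A B d e G H} → A ≡₂ true → B ≡₂ true → VanishesAbove d G → VanishesAbove e H →
  G ⊛ H ≗ octic A B → T (mod2-verdict d e) → d ≡ 4 × (∀ i → i < 5 → G i ≡₂ true)
mod2-factor-shape {A} {B} {d} {e} {G} {H} A-odd B-odd G↑ H↑ GH≗F verdict = d≡4 , G-odd
  where
  β γ : ℕ → Bool
  β = parity ∘ G
  γ = parity ∘ H
  l₁ l₂ : List Bool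
  l₁ = List.applyUpTo β (suc d)
  l₂ = List.applyUpTo γ (suc e)

  reduction : lookupOr false l₁ 𝔽₂⊛.⊛ lookupOr false l₂ ≗ octic₂
  reduction k = begin
    (lookupOr false l₁ 𝔽₂⊛.⊛ lookupOr false l₂) k
      ≡⟨ 𝔽₂⊛.⊛-cong (lookupOr-applyUpTo false β (suc d) (λ i d<i → cong parity (G↑ i d<i)))
                    (lookupOr-applyUpTo false γ (suc e) (λ j e<j → cong parity (H↑ j e<j))) k ⟩
    (β 𝔽₂⊛.⊛ γ) k         ≡⟨ sym (parity-⊛ G H k) ⟩
    parity ((G ⊛ H) k)    ≡⟨ cong parity (GH≗F k) ⟩
    parity (octic A B k)  ≡⟨ parity-octic A-odd B-odd k ⟩
    octic₂ k              ∎
    where open ≡-Reasoning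

  agrees : T (agreeUpTo 8 (lookupOr false l₁ 𝔽₂⊛.⊛ lookupOr false l₂) octic₂)
  agrees = T-and-applyUpTo⁺ (λ k → ⌊ (lookupOr false l₁ 𝔽₂⊛.⊛ lookupOr false l₂) k Bool.≟ octic₂ k ⌋) 9
                            (fromWitness ∘ reduction)

  shape : T ((d ℕ.≡ᵇ 4) ∧ and l₁)
  shape with Equivalence.to T-∨ (∀-bits-sound (suc e) (product-forces-shape d l₁)
               (∀-bits-sound (suc d) (λ l → ∀-bits (suc e) (product-forces-shape d l)) verdict β) γ)
  ... | inj₂ shape′  = shape′
  ... | inj₁ disagrees = ⊥-elim (subst T (Equivalence.to Bool.T-not-≡ disagrees) agrees)

  d≡4 : d ≡ 4
  d≡4 = ℕ.≡ᵇ⇒≡ d 4 (proj₁ (Equivalence.to (T-∧ {d ℕ.≡ᵇ 4}) shape))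

  G-odd : ∀ i → i < 5 → G i ≡₂ true
  G-odd i i<5 = subst (G i ≡₂_) (Equivalence.to Bool.T-≡ βi) (≡₂-parity (G i))
    where
    all-odd : T (and l₁)
    all-odd = proj₂ (Equivalence.to (T-∧ {d ℕ.≡ᵇ 4}) shape)
    βi : T (β i)
    βi = T-and-applyUpTo⁻ β (suc d) all-odd i (subst (λ n → i < suc n) (sym d≡4) i<5)

-- Quartic factors

quarticCoefficients : ℤ → ℤ → ℤ → ℤ → List ℤ
quarticCoefficients g₀ g₁ g₂ g₃ = g₀ ∷ g₁ ∷ g₂ ∷ g₃ ∷ + 1 ∷ []

quartic : ℤ → ℤ → ℤ → ℤ → ℕ → ℤ
quartic g₀ g₁ g₂ g₃ = lookupOr (+ 0) (quarticCoefficients g₀ g₁ g₂ g₃)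

monic-quartic : ∀ {G} → VanishesAbove 4 G → G 4 ≡ + 1 → G ≗ quartic (G 0) (G 1) (G 2) (G 3)
monic-quartic G↑ G₄≡1 0 = refl
monic-quartic G↑ G₄≡1 1 = refl
monic-quartic G↑ G₄≡1 2 = refl
monic-quartic G↑ G₄≡1 3 = refl
monic-quartic G↑ G₄≡1 4 = G₄≡1
monic-quartic G↑ G₄≡1 (suc (suc (suc (suc (suc i))))) = G↑ _ (s≤s (s≤s (s≤s (s≤s (s≤s z≤n)))))

quarticProduct : (g₀ g₁ g₂ g₃ h₀ h₁ h₂ h₃ : ℤ) → List ℤ
quarticProduct g₀ g₁ g₂ g₃ h₀ h₁ h₂ h₃ =
  g₀ * h₀ ∷ g₀ * h₁ + g₁ * h₀ ∷ g₀ * h₂ + g₁ * h₁ + g₂ * h₀ ∷ g₀ * h₃ + g₁ * h₂ + g₂ * h₁ + g₃ * h₀ ∷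
  g₀ + g₁ * h₃ + g₂ * h₂ + g₃ * h₁ + h₀ ∷ g₁ + g₂ * h₃ + g₃ * h₂ + h₁ ∷ g₂ + g₃ * h₃ + h₂ ∷ g₃ + h₃ ∷ + 1 ∷ []

-- The left-hand sides of the cₖ below are the definitional unfoldings of the k-th convolution coefficient.
quartic-⊛ : ∀ g₀ g₁ g₂ g₃ h₀ h₁ h₂ h₃ →
  quartic g₀ g₁ g₂ g₃ ⊛ quartic h₀ h₁ h₂ h₃ ≗ lookupOr (+ 0) (quarticProduct g₀ g₁ g₂ g₃ h₀ h₁ h₂ h₃)
quartic-⊛ g₀ g₁ g₂ g₃ h₀ h₁ h₂ h₃ 0 = refl
quartic-⊛ g₀ g₁ g₂ g₃ h₀ h₁ h₂ h₃ 1 = refl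
quartic-⊛ g₀ g₁ g₂ g₃ h₀ h₁ h₂ h₃ 2 = c₂ g₀ g₁ g₂ h₀ h₁ h₂
  where
  c₂ : ∀ g₀ g₁ g₂ h₀ h₁ h₂ → g₀ * h₂ + (g₁ * h₁ + g₂ * h₀) ≡ g₀ * h₂ + g₁ * h₁ + g₂ * h₀
  c₂ = solve-∀
quartic-⊛ g₀ g₁ g₂ g₃ h₀ h₁ h₂ h₃ 3 = c₃ g₀ g₁ g₂ g₃ h₀ h₁ h₂ h₃
  where
  c₃ : ∀ g₀ g₁ g₂ g₃ h₀ h₁ h₂ h₃ →
       g₀ * h₃ + (g₁ * h₂ + (g₂ * h₁ + g₃ * h₀)) ≡ g₀ * h₃ + g₁ * h₂ + g₂ * h₁ + g₃ * h₀
  c₃ = solve-∀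
quartic-⊛ g₀ g₁ g₂ g₃ h₀ h₁ h₂ h₃ 4 = c₄ g₀ g₁ g₂ g₃ h₀ h₁ h₂ h₃
  where
  c₄ : ∀ g₀ g₁ g₂ g₃ h₀ h₁ h₂ h₃ →
       g₀ * + 1 + (g₁ * h₃ + (g₂ * h₂ + (g₃ * h₁ + + 1 * h₀))) ≡ g₀ + g₁ * h₃ + g₂ * h₂ + g₃ * h₁ + h₀
  c₄ = solve-∀
quartic-⊛ g₀ g₁ g₂ g₃ h₀ h₁ h₂ h₃ 5 = c₅ g₀ g₁ g₂ g₃ h₀ h₁ h₂ h₃
  where
  c₅ : ∀ g₀ g₁ g₂ g₃ h₀ h₁ h₂ h₃ →
       g₀ * + 0 + (g₁ * + 1 + (g₂ * h₃ + (g₃ * h₂ + (+ 1 * h₁ + + 0 * h₀)))) ≡ g₁ + g₂ * h₃ + g₃ * h₂ + h₁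
  c₅ = solve-∀
quartic-⊛ g₀ g₁ g₂ g₃ h₀ h₁ h₂ h₃ 6 = c₆ g₀ g₁ g₂ g₃ h₀ h₁ h₂ h₃
  where
  c₆ : ∀ g₀ g₁ g₂ g₃ h₀ h₁ h₂ h₃ →
       g₀ * + 0 + (g₁ * + 0 + (g₂ * + 1 + (g₃ * h₃ + (+ 1 * h₂ + (+ 0 * h₁ + + 0 * h₀))))) ≡ g₂ + g₃ * h₃ + h₂
  c₆ = solve-∀
quartic-⊛ g₀ g₁ g₂ g₃ h₀ h₁ h₂ h₃ 7 = c₇ g₀ g₁ g₂ g₃ h₀ h₁ h₂ h₃
  where
  c₇ : ∀ g₀ g₁ g₂ g₃ h₀ h₁ h₂ h₃ →
       g₀ * + 0 + (g₁ * + 0 + (g₂ * + 0 + (g₃ * + 1 + (+ 1 * h₃ + (+ 0 * h₂ + (+ 0 * h₁ + + 0 * h₀)))))) ≡ g₃ + h₃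
  c₇ = solve-∀
quartic-⊛ g₀ g₁ g₂ g₃ h₀ h₁ h₂ h₃ 8 = c₈ g₀ g₁ g₂ g₃ h₀ h₁ h₂ h₃
  where
  c₈ : ∀ g₀ g₁ g₂ g₃ h₀ h₁ h₂ h₃ →
       g₀ * + 0 + (g₁ * + 0 + (g₂ * + 0 + (g₃ * + 0 + (+ 1 * + 1 + (+ 0 * h₃ + (+ 0 * h₂ + (+ 0 * h₁ + + 0 * h₀))))))) ≡ + 1
  c₈ = solve-∀
quartic-⊛ g₀ g₁ g₂ g₃ h₀ h₁ h₂ h₃ k@(suc (suc (suc (suc (suc (suc (suc (suc (suc _))))))))) =
  ⊛-vanishesAbove 4 4 (quartic g₀ g₁ g₂ g₃) (quartic h₀ h₁ h₂ h₃)
    (quartic-vanishes g₀ g₁ g₂ g₃) (quartic-vanishes h₀ h₁ h₂ h₃) k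
    (s≤s (s≤s (s≤s (s≤s (s≤s (s≤s (s≤s (s≤s (s≤s z≤n)))))))))
  where
  quartic-vanishes : ∀ a b c d → VanishesAbove 4 (quartic a b c d)
  quartic-vanishes a b c d = lookupOr-beyond (+ 0) (quarticCoefficients a b c d)

-- The coefficients of G(x) · G(-x) for G = x⁴ + g₃x³ + g₂x² + g₁x + ε.
reflectedProduct : ℤ → ℤ → ℤ → ℤ → List ℤ
reflectedProduct ε g₁ g₂ g₃ =
  ε * ε ∷ + 0 ∷ + 2 * (ε * g₂) - g₁ * g₁ ∷ + 0 ∷ + 2 * ε + g₂ * g₂ - + 2 * (g₁ * g₃) ∷ + 0 ∷
  + 2 * g₂ - g₃ * g₃ ∷ + 0 ∷ + 1 ∷ []

quarticProduct-reflected : ∀ ε g₁ g₂ g₃ →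
  lookupOr (+ 0) (quarticProduct ε g₁ g₂ g₃ ε (- g₁) g₂ (- g₃)) ≗ lookupOr (+ 0) (reflectedProduct ε g₁ g₂ g₃)
quarticProduct-reflected ε g₁ g₂ g₃ 0 = refl
quarticProduct-reflected ε g₁ g₂ g₃ 1 = r₁ ε g₁
  where
  r₁ : ∀ ε g₁ → ε * - g₁ + g₁ * ε ≡ + 0
  r₁ = solve-∀
quarticProduct-reflected ε g₁ g₂ g₃ 2 = r₂ ε g₁ g₂
  where
  r₂ : ∀ ε g₁ g₂ → ε * g₂ + g₁ * - g₁ + g₂ * ε ≡ + 2 * (ε * g₂) - g₁ * g₁
  r₂ = solve-∀
quarticProduct-reflected ε g₁ g₂ g₃ 3 = r₃ ε g₁ g₂ g₃
  where
  r₃ : ∀ ε g₁ g₂ g₃ → ε * - g₃ + g₁ * g₂ + g₂ * - g₁ + g₃ * ε ≡ + 0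
  r₃ = solve-∀
quarticProduct-reflected ε g₁ g₂ g₃ 4 = r₄ ε g₁ g₂ g₃
  where
  r₄ : ∀ ε g₁ g₂ g₃ → ε + g₁ * - g₃ + g₂ * g₂ + g₃ * - g₁ + ε ≡ + 2 * ε + g₂ * g₂ - + 2 * (g₁ * g₃)
  r₄ = solve-∀
quarticProduct-reflected ε g₁ g₂ g₃ 5 = r₅ g₁ g₂ g₃
  where
  r₅ : ∀ g₁ g₂ g₃ → g₁ + g₂ * - g₃ + g₃ * g₂ + - g₁ ≡ + 0
  r₅ = solve-∀
quarticProduct-reflected ε g₁ g₂ g₃ 6 = r₆ g₂ g₃
  where
  r₆ : ∀ g₂ g₃ → g₂ + g₃ * - g₃ + g₂ ≡ + 2 * g₂ - g₃ * g₃
  r₆ = solve-∀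
quarticProduct-reflected ε g₁ g₂ g₃ 7 = ℤ.+-inverseʳ g₃
quarticProduct-reflected ε g₁ g₂ g₃ (suc (suc (suc (suc (suc (suc (suc (suc _)))))))) = refl

unit-product : ∀ x y → x * y ≡ + 1 → (x ≡ + 1 × y ≡ + 1) ⊎ (x ≡ - + 1 × y ≡ - + 1)
unit-product x y xy≡1 with ±1 x (ℕ.m*n≡1⇒m≡1 ∣ x ∣ ∣ y ∣ ∣xy∣≡1)
  where
  ∣xy∣≡1 : ∣ x ∣ ℕ.* ∣ y ∣ ≡ 1
  ∣xy∣≡1 = trans (sym (ℤ.abs-* x y)) (cong ∣_∣ xy≡1)
  ±1 : ∀ x → ∣ x ∣ ≡ 1 → x ≡ + 1 ⊎ x ≡ - + 1
  ±1 (+ _)    refl = inj₁ refl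
  ±1 -[1+ _ ] refl = inj₂ refl
... | inj₁ refl = inj₁ (refl , trans (sym (ℤ.*-identityˡ y)) xy≡1)
... | inj₂ refl = inj₂ (refl , trans (sym (ℤ.neg-involutive y)) (cong -_ (trans (sym (ℤ.-1*i≡-i y)) xy≡1)))

x+y≡0⇒y≡-x : ∀ x y → x + y ≡ + 0 → y ≡ - x
x+y≡0⇒y≡-x x y x+y≡0 = begin
  y                 ≡⟨ y≡[x+y]-x x y ⟩
  (x + y) - x       ≡⟨ cong (_- x) x+y≡0 ⟩
  + 0 - x           ≡⟨ ℤ.+-identityˡ (- x) ⟩
  - x               ∎
  where
  open ≡-Reasoning
  y≡[x+y]-x : ∀ x y → y ≡ (x + y) - x
  y≡[x+y]-x = solve-∀

reflected-factor : ∀ {ε g₁ g₂ g₃ h₁ h₂ h₃} → ε ≢ + 0 → g₃ ≢ + 0 →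
  ε * h₁ + g₁ * ε ≡ + 0 → g₁ + g₂ * h₃ + g₃ * h₂ + h₁ ≡ + 0 → g₃ + h₃ ≡ + 0 →
  h₁ ≡ - g₁ × h₂ ≡ g₂ × h₃ ≡ - g₃
reflected-factor {ε} {g₁} {g₂} {g₃} {h₁} {h₂} {h₃} ε≢0 g₃≢0 c₁ c₅ c₇ =
  x+y≡0⇒y≡-x g₁ h₁ g₁+h₁≡0 , h₂≡g₂ , x+y≡0⇒y≡-x g₃ h₃ c₇
  where
  open ≡-Reasoning
  g₁+h₁≡0 : g₁ + h₁ ≡ + 0
  g₁+h₁≡0 = [ ⊥-elim ∘ ε≢0 , (λ eq → eq) ]′ (ℤ.i*j≡0⇒i≡0∨j≡0 ε (trans (expand ε g₁ h₁) c₁))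
    where
    expand : ∀ ε g h → ε * (g + h) ≡ ε * h + g * ε
    expand = solve-∀
  h₂≡g₂ : h₂ ≡ g₂
  h₂≡g₂ = ℤ.i-j≡0⇒i≡j h₂ g₂ ([ ⊥-elim ∘ g₃≢0 , (λ eq → eq) ]′ (ℤ.i*j≡0⇒i≡0∨j≡0 g₃ (begin
    g₃ * (h₂ - g₂)                                                    ≡⟨ combine g₁ g₂ g₃ h₁ h₂ h₃ ⟩
    (g₁ + g₂ * h₃ + g₃ * h₂ + h₁) - (g₁ + h₁) - g₂ * (g₃ + h₃)
                                                        ≡⟨ cong₂ (λ a b → a - b - g₂ * (g₃ + h₃)) c₅ g₁+h₁≡0 ⟩
    + 0 - + 0 - g₂ * (g₃ + h₃)                                        ≡⟨ cong (λ a → + 0 - + 0 - g₂ * a) c₇ ⟩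
    + 0 - + 0 - g₂ * + 0                                              ≡⟨ cong (λ a → + 0 - + 0 - a) (ℤ.*-zeroʳ g₂) ⟩
    + 0                                                               ∎)))
    where
    combine : ∀ g₁ g₂ g₃ h₁ h₂ h₃ → g₃ * (h₂ - g₂) ≡ (g₁ + g₂ * h₃ + g₃ * h₂ + h₁) - (g₁ + h₁) - g₂ * (g₃ + h₃)
    combine = solve-∀

ReducibilityCondition : ℤ → ℤ → Set
ReducibilityCondition A B =
  ∃[ s ] ∃[ t ] ((A ≡ + 4 * t - + 4 * (s * s) - + 4 * s + + 1) ×
    ((B ≡ + 4 * (t * t) + + 4 * t - + 8 * (s * s) - + 8 * s + + 1)
     ⊎ (B ≡ + 4 * (t * t) + + 4 * t + + 8 * (s * s) + + 8 * s + + 5)))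

-- The coefficients of x² and x⁴ in reflectedProduct for ε = 1, g₁ = 2s + 1, g₂ = 2t + 1 and g₃ = ±g₁.
x²-coefficient : ∀ s t → let g₁ = + 1 + s * + 2 ; g₂ = + 1 + t * + 2 in
  + 2 * (+ 1 * g₂) - g₁ * g₁ ≡ + 4 * t - + 4 * (s * s) - + 4 * s + + 1
x²-coefficient = solve-∀

x⁴-coefficient⁺ : ∀ s t → let g₁ = + 1 + s * + 2 ; g₂ = + 1 + t * + 2 in
  + 2 + g₂ * g₂ - + 2 * (g₁ * g₁) ≡ + 4 * (t * t) + + 4 * t - + 8 * (s * s) - + 8 * s + + 1
x⁴-coefficient⁺ = solve-∀

x⁴-coefficient⁻ : ∀ s t → let g₁ = + 1 + s * + 2 ; g₂ = + 1 + t * + 2 in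
  + 2 + g₂ * g₂ - + 2 * (g₁ * - g₁) ≡ + 4 * (t * t) + + 4 * t + + 8 * (s * s) + + 8 * s + + 5
x⁴-coefficient⁻ = solve-∀

positive-constant-terms : ∀ {A B g₁ g₂ g₃} → g₁ ≡₂ true → g₂ ≡₂ true →
  + 2 * (+ 1 * g₂) - g₁ * g₁ ≡ A → + 2 + g₂ * g₂ - + 2 * (g₁ * g₃) ≡ B → + 2 * g₂ - g₃ * g₃ ≡ A →
  ReducibilityCondition A B
positive-constant-terms {A} {B} {g₁} {g₂} {g₃} (mod2 s refl) (mod2 t refl) c₂ c₄ c₆
  with ℤ.i*j≡0⇒i≡0∨j≡0 (g₃ - g₁) (begin
    (g₃ - g₁) * (g₃ + g₁)                                  ≡⟨ difference-of-squares g₁ g₂ g₃ ⟩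
    (+ 2 * (+ 1 * g₂) - g₁ * g₁) - (+ 2 * g₂ - g₃ * g₃)    ≡⟨ cong₂ _-_ c₂ c₆ ⟩
    A - A                                                  ≡⟨ ℤ.+-inverseʳ A ⟩
    + 0                                                    ∎)
  where
  open ≡-Reasoning
  difference-of-squares : ∀ g₁ g₂ g₃ → (g₃ - g₁) * (g₃ + g₁) ≡ (+ 2 * (+ 1 * g₂) - g₁ * g₁) - (+ 2 * g₂ - g₃ * g₃)
  difference-of-squares = solve-∀
... | inj₁ g₃-g₁≡0 with ℤ.i-j≡0⇒i≡j g₃ g₁ g₃-g₁≡0
...   | refl = s , t , trans (sym c₂) (x²-coefficient s t) , inj₁ (trans (sym c₄) (x⁴-coefficient⁺ s t))
positive-constant-terms {A} {B} {g₁} {g₂} {g₃} (mod2 s refl) (mod2 t refl) c₂ c₄ c₆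
  | inj₂ g₃+g₁≡0 with x+y≡0⇒y≡-x g₁ g₃ (trans (ℤ.+-comm g₁ g₃) g₃+g₁≡0)
...   | refl = s , t , trans (sym c₂) (x²-coefficient s t) , inj₂ (trans (sym c₄) (x⁴-coefficient⁻ s t))

-- With constant terms -1 one gets 4 g₂ = g₃² - g₁², which is impossible for odd g₁, g₂, g₃.
negative-constant-terms : ∀ {A g₁ g₂ g₃} → g₁ ≡₂ true → g₂ ≡₂ true → g₃ ≡₂ true →
  + 2 * (- + 1 * g₂) - g₁ * g₁ ≡ A → + 2 * g₂ - g₃ * g₃ ≡ A → ⊥
negative-constant-terms {A} {g₁} {g₂} {g₃} (mod2 s refl) g₂-odd (mod2 u refl) c₂ c₆ =
  case ≡₂-unique (≡₂-+ g₂-odd (n[n+1]-even s)) (subst (_≡₂ false) (sym balance) (n[n+1]-even u)) of λ ()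
  where
  open ≡-Reasoning
  balance : g₂ + s * (s + + 1) ≡ u * (u + + 1)
  balance = ℤ.*-cancelˡ-≡ (+ 4) _ _ (begin
    + 4 * (g₂ + s * (s + + 1))
      ≡⟨ rearrange s u g₂ ⟩
    (+ 2 * g₂ - g₃ * g₃) - (+ 2 * (- + 1 * g₂) - g₁ * g₁) + + 4 * (u * (u + + 1))
      ≡⟨ cong (_+ + 4 * (u * (u + + 1))) (trans (cong₂ _-_ c₆ c₂) (ℤ.+-inverseʳ A)) ⟩
    + 0 + + 4 * (u * (u + + 1))
      ≡⟨ ℤ.+-identityˡ _ ⟩
    + 4 * (u * (u + + 1)) ∎)
    where
    rearrange : ∀ s u g₂ → let g₁ = + 1 + s * + 2 ; g₃ = + 1 + u * + 2 in
      + 4 * (g₂ + s * (s + + 1)) ≡ (+ 2 * g₂ - g₃ * g₃) - (+ 2 * (- + 1 * g₂) - g₁ * g₁) + + 4 * (u * (u + + 1))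
    rearrange = solve-∀

monic-quartic-factors : ∀ {A B} g₀ g₁ g₂ g₃ h₀ h₁ h₂ h₃ → g₁ ≡₂ true → g₂ ≡₂ true → g₃ ≡₂ true →
  lookupOr (+ 0) (quarticProduct g₀ g₁ g₂ g₃ h₀ h₁ h₂ h₃) ≗ octic A B → ReducibilityCondition A B
monic-quartic-factors {A} {B} g₀ g₁ g₂ g₃ h₀ h₁ h₂ h₃ g₁-odd g₂-odd g₃-odd c
  with unit-product g₀ h₀ (c 0)
... | inj₁ (refl , refl)
  with reflected-factor {+ 1} {g₁} {g₂} {g₃} {h₁} {h₂} {h₃} (λ ()) (odd⇒≢0 g₃-odd) (c 1) (c 5) (c 7)
... | refl , refl , refl = positive-constant-terms g₁-odd g₂-odd (c′ 2) (c′ 4) (c′ 6)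
  where
  c′ : lookupOr (+ 0) (reflectedProduct (+ 1) g₁ g₂ g₃) ≗ octic A B
  c′ k = trans (sym (quarticProduct-reflected (+ 1) g₁ g₂ g₃ k)) (c k)
monic-quartic-factors {A} {B} g₀ g₁ g₂ g₃ h₀ h₁ h₂ h₃ g₁-odd g₂-odd g₃-odd c
  | inj₂ (refl , refl)
  with reflected-factor { - + 1} {g₁} {g₂} {g₃} {h₁} {h₂} {h₃} (λ ()) (odd⇒≢0 g₃-odd) (c 1) (c 5) (c 7)
... | refl , refl , refl = ⊥-elim (negative-constant-terms g₁-odd g₂-odd g₃-odd (c′ 2) (c′ 6))
  where
  c′ : lookupOr (+ 0) (reflectedProduct (- + 1) g₁ g₂ g₃) ≗ octic A B
  c′ k = trans (sym (quarticProduct-reflected (- + 1) g₁ g₂ g₃ k)) (c k)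

-- Rescaling both factors by the unit σ = G 4 makes them monic without changing their product.
quartic-factors : ∀ {A B G H} → VanishesAbove 4 G → VanishesAbove 4 H → G ⊛ H ≗ octic A B →
  (∀ i → i < 5 → G i ≡₂ true) → ReducibilityCondition A B
quartic-factors {A} {B} {G} {H} G↑ H↑ GH≗F G-odd =
  monic-quartic-factors (σG 0) (σG 1) (σG 2) (σG 3) (σH 0) (σH 1) (σH 2) (σH 3)
    (σG-odd 1 (ℕ.<ᵇ⇒< 1 5 _)) (σG-odd 2 (ℕ.<ᵇ⇒< 2 5 _)) (σG-odd 3 (ℕ.<ᵇ⇒< 3 5 _)) λ k → begin
    lookupOr (+ 0) (quarticProduct (σG 0) (σG 1) (σG 2) (σG 3) (σH 0) (σH 1) (σH 2) (σH 3)) k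
      ≡⟨ sym (quartic-⊛ (σG 0) (σG 1) (σG 2) (σG 3) (σH 0) (σH 1) (σH 2) (σH 3) k) ⟩
    (quartic (σG 0) (σG 1) (σG 2) (σG 3) ⊛ quartic (σH 0) (σH 1) (σH 2) (σH 3)) k
      ≡⟨ sym (⊛-cong (monic-quartic (scaled-vanishes G↑) σ*σ≡1) (monic-quartic (scaled-vanishes H↑) G₄H₄≡1) k) ⟩
    (σG ⊛ σH) k
      ≡⟨ ⊛-scaleˡ σ G σH k ⟩
    σ * (G ⊛ σH) k
      ≡⟨ cong (σ *_) (⊛-scaleʳ σ G H k) ⟩
    σ * (σ * (G ⊛ H) k)
      ≡⟨ sym (ℤ.*-assoc σ σ _) ⟩
    σ * σ * (G ⊛ H) k
      ≡⟨ cong₂ _*_ σ*σ≡1 (GH≗F k) ⟩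
    + 1 * octic A B k
      ≡⟨ ℤ.*-identityˡ _ ⟩
    octic A B k ∎
  where
  open ≡-Reasoning
  σ : ℤ
  σ = G 4
  σG σH : ℕ → ℤ
  σG i = σ * G i
  σH i = σ * H i
  G₄H₄≡1 : G 4 * H 4 ≡ + 1
  G₄H₄≡1 = trans (sym (⊛-leading 4 4 G H G↑ H↑)) (GH≗F 8)
  σ*σ≡1 : σ * σ ≡ + 1
  σ*σ≡1 = [ (λ (σ≡1 , _) → cong₂ _*_ σ≡1 σ≡1) , (λ (σ≡-1 , _) → cong₂ _*_ σ≡-1 σ≡-1) ]′
            (unit-product (G 4) (H 4) G₄H₄≡1)
  scaled-vanishes : ∀ {F} → VanishesAbove 4 F → VanishesAbove 4 (λ i → σ * F i)
  scaled-vanishes F↑ i 4<i = trans (cong (σ *_) (F↑ i 4<i)) (ℤ.*-zeroʳ σ)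
  σG-odd : ∀ i → i < 5 → σG i ≡₂ true
  σG-odd i i<5 = ≡₂-* (G-odd 4 ℕ.≤-refl) (G-odd i i<5)

octic-factorisation⇒condition : ∀ {A B d e G H} → A ≡₂ true → B ≡₂ true → 1 ≤ d → 1 ≤ e → d ℕ.+ e ≡ 8 →
  VanishesAbove d G → VanishesAbove e H → G ⊛ H ≗ octic A B → ReducibilityCondition A B
octic-factorisation⇒condition {d = d} {e} A-odd B-odd 1≤d 1≤e d+e≡8 G↑ H↑ GH≗F
  with mod2-factor-shape A-odd B-odd G↑ H↑ GH≗F (mod2-verdict-holds d e 1≤d 1≤e d+e≡8)
... | refl , G-odd with d+e≡8
... | refl = quartic-factors G↑ H↑ GH≗F G-odd

reducible⇒condition : ∀ {A B} → A ≡₂ true → B ≡₂ true → ReducibleQ (F3 A B) → ReducibilityCondition A B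
reducible⇒condition {A} {B} A-odd B-odd reducible
  with reducible⇒integral-factorisation {F3 A B} (coeff-F3 A B) reducible
... | d , e , 1≤d , 1≤e , φ =
  octic-factorisation⇒condition A-odd B-odd 1≤d 1≤e d+e≡8 (proj₁ left-degree) (proj₁ right-degree) GH≗F
  where
  open ScaledFactorisation φ
  GH≗F : left ⊛ right ≗ octic A B
  GH≗F k = trans (is-product k) (ℤ.*-identityˡ (octic A B k))
  d+e≡8 : d ℕ.+ e ≡ 8
  d+e≡8 = degree-unique GH≗F (⊛-degree left-degree right-degree) (octic-degree A B)

-- Realising the two families

monic-quartic-degree : ∀ g₀ g₁ g₂ g₃ → HasDegree (List.map toℚ (quarticCoefficients g₀ g₁ g₂ g₃)) 4
monic-quartic-degree g₀ g₁ g₂ g₃ = (λ ()) , λ k 4<k →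
  trans (coeff-map-toℚ (quarticCoefficients g₀ g₁ g₂ g₃) k)
        (cong toℚ (lookupOr-beyond (+ 0) (quarticCoefficients g₀ g₁ g₂ g₃) k 4<k))

reflectedProduct≗octic : ∀ {A B} g₁ g₂ g₃ → + 2 * (+ 1 * g₂) - g₁ * g₁ ≡ A → + 2 + g₂ * g₂ - + 2 * (g₁ * g₃) ≡ B →
  g₃ * g₃ ≡ g₁ * g₁ → lookupOr (+ 0) (reflectedProduct (+ 1) g₁ g₂ g₃) ≗ octic A B
reflectedProduct≗octic _ _ _ c₂ c₄ g₃²≡g₁² 0 = refl
reflectedProduct≗octic _ _ _ c₂ c₄ g₃²≡g₁² 1 = refl
reflectedProduct≗octic _ _ _ c₂ c₄ g₃²≡g₁² 2 = c₂
reflectedProduct≗octic _ _ _ c₂ c₄ g₃²≡g₁² 3 = refl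
reflectedProduct≗octic _ _ _ c₂ c₄ g₃²≡g₁² 4 = c₄
reflectedProduct≗octic _ _ _ c₂ c₄ g₃²≡g₁² 5 = refl
reflectedProduct≗octic g₁ g₂ g₃ c₂ c₄ g₃²≡g₁² 6 =
  trans (cong₂ (λ x y → + 2 * x - y) (sym (ℤ.*-identityˡ g₂)) g₃²≡g₁²) c₂
reflectedProduct≗octic _ _ _ c₂ c₄ g₃²≡g₁² 7 = refl
reflectedProduct≗octic _ _ _ c₂ c₄ g₃²≡g₁² (suc (suc (suc (suc (suc (suc (suc (suc _)))))))) = refl

reflected-factors⇒reducible : ∀ {A B} g₁ g₂ g₃ →
  + 2 * (+ 1 * g₂) - g₁ * g₁ ≡ A → + 2 + g₂ * g₂ - + 2 * (g₁ * g₃) ≡ B → g₃ * g₃ ≡ g₁ * g₁ →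
  ReducibleQ (F3 A B)
reflected-factors⇒reducible {A} {B} g₁ g₂ g₃ c₂ c₄ g₃²≡g₁² =
  g , h , 4 , 4 , monic-quartic-degree (+ 1) g₁ g₂ g₃ , monic-quartic-degree (+ 1) (- g₁) g₂ (- g₃) ,
  s≤s z≤n , s≤s z≤n , λ k → begin
    coeff (F3 A B) k
      ≡⟨ coeff-F3 A B k ⟩
    toℚ (octic A B k)
      ≡⟨ cong toℚ (sym (trans (quartic-⊛ (+ 1) g₁ g₂ g₃ (+ 1) (- g₁) g₂ (- g₃) k)
                              (trans (quarticProduct-reflected (+ 1) g₁ g₂ g₃ k)
                                     (reflectedProduct≗octic g₁ g₂ g₃ c₂ c₄ g₃²≡g₁² k)))) ⟩
    toℚ ((G ⊛ G⁻) k)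
      ≡⟨ toℚ-⊛ G G⁻ k ⟩
    ((toℚ ∘ G) ℚ⊛.⊛ (toℚ ∘ G⁻)) k
      ≡⟨ sym (ℚ⊛.⊛-cong (coeff-map-toℚ (quarticCoefficients (+ 1) g₁ g₂ g₃))
                        (coeff-map-toℚ (quarticCoefficients (+ 1) (- g₁) g₂ (- g₃))) k) ⟩
    (coeff g ℚ⊛.⊛ coeff h) k
      ≡⟨ sym (conv≗⊛ g h k) ⟩
    conv g h k ∎
  where
  open ≡-Reasoning
  G G⁻ : ℕ → ℤ
  G  = quartic (+ 1) g₁ g₂ g₃
  G⁻ = quartic (+ 1) (- g₁) g₂ (- g₃)
  g h : Poly
  g = List.map toℚ (quarticCoefficients (+ 1) g₁ g₂ g₃)
  h = List.map toℚ (quarticCoefficients (+ 1) (- g₁) g₂ (- g₃))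

condition⇒reducible : ∀ {A B} → ReducibilityCondition A B → ReducibleQ (F3 A B)
condition⇒reducible (s , t , refl , inj₁ refl) =
  reflected-factors⇒reducible (+ 1 + s * + 2) (+ 1 + t * + 2) (+ 1 + s * + 2)
    (x²-coefficient s t) (x⁴-coefficient⁺ s t) refl
condition⇒reducible (s , t , refl , inj₂ refl) =
  reflected-factors⇒reducible (+ 1 + s * + 2) (+ 1 + t * + 2) (- (+ 1 + s * + 2))
    (x²-coefficient s t) (x⁴-coefficient⁻ s t) (-x*-x≡x*x (+ 1 + s * + 2))
  where
  -x*-x≡x*x : ∀ x → - x * - x ≡ x * x
  -x*-x≡x*x = solve-∀

theorem1p2 : (A B : ℤ) → (+ 4) ∣ (A - + 1) → (+ 4) ∣ (B - + 1) →
    ReducibleQ (F3 A B) ⇔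
      (∃[ s ] ∃[ t ] ((A ≡ + 4 * t - + 4 * (s * s) - + 4 * s + + 1) ×
        ((B ≡ + 4 * (t * t) + + 4 * t - + 8 * (s * s) - + 8 * s + + 1)
         ⊎ (B ≡ + 4 * (t * t) + + 4 * t + + 8 * (s * s) + + 8 * s + + 5))))
theorem1p2 A B 4∣A-1 4∣B-1 = mk⇔ (reducible⇒condition (4∣x-1⇒odd 4∣A-1) (4∣x-1⇒odd 4∣B-1)) condition⇒reducible
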